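{- Let $e \geq 2$ be an even integer and let $\omega = \sqrt[e]{2}$. Then $\omega^{e+1} = 2\omega$ cannot be written as $x^2 + y^2$ with $x, y \in \mathbb{Z}_2[\omega]$.
   Context: $\mathbb{Z}_2[\omega]$ is the ring of integers of the totally ramified extension $\mathbb{Q}_2(\omega)$ of the $2$-adic numbers. -}

module Defs where

open import Data.Nat using (ℕ; zero; suc; _+_; _*_; _^_; NonZero; _≟_)
open import Data.Nat.Properties using (m^n≢0)
open import Data.Nat.DivMod using (_%_; %-distribˡ-+; %-distribˡ-*)
open import Data.Fin using (Fin; toℕ)
open import Data.Vec.Functional using (foldr; map)
open import Relation.Nullary using (yes; no)
open import Relation.Binary.PropositionalEquality using (_≡_; refl; cong₂; trans; sym)

infixl 7 _mod2^_
_mod2^_ : ℕ → ℕ → ℕ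
x mod2^ n = _%_ x (2 ^ n) {{m^n≢0 2 n}}

-- The 2-adic integers ℤ₂ = lim Z/2^n Z, presented as coherent sequences
-- of representatives: seq n represents the residue class mod 2^n.

record ℤ₂ : Set where
  constructor mkℤ₂
  field
    seq : ℕ → ℕ
    coh : ∀ n → seq (suc n) mod2^ n ≡ seq n mod2^ n
open ℤ₂ public

_≈₂_ : ℤ₂ → ℤ₂ → Set
x ≈₂ y = ∀ n → seq x n mod2^ n ≡ seq y n mod2^ n

const₂ : ℕ → ℤ₂
const₂ k = mkℤ₂ (λ _ → k) (λ _ → refl)

0₂ 1₂ 2₂ : ℤ₂
0₂ = const₂ 0
1₂ = const₂ 1
2₂ = const₂ 2

_+₂_ : ℤ₂ → ℤ₂ → ℤ₂
x +₂ y = mkℤ₂ (λ n → seq x n + seq y n) pf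
  where
  pf : ∀ n → (seq x (suc n) + seq y (suc n)) mod2^ n ≡ (seq x n + seq y n) mod2^ n
  pf n = trans (%-distribˡ-+ (seq x (suc n)) (seq y (suc n)) (2 ^ n) {{m^n≢0 2 n}})
         (trans (cong₂ (λ a b → (a + b) mod2^ n) (coh x n) (coh y n))
                (sym (%-distribˡ-+ (seq x n) (seq y n) (2 ^ n) {{m^n≢0 2 n}})))

_*₂_ : ℤ₂ → ℤ₂ → ℤ₂
x *₂ y = mkℤ₂ (λ n → seq x n * seq y n) pf
  where
  pf : ∀ n → (seq x (suc n) * seq y (suc n)) mod2^ n ≡ (seq x n * seq y n) mod2^ n
  pf n = trans (%-distribˡ-* (seq x (suc n)) (seq y (suc n)) (2 ^ n) {{m^n≢0 2 n}})
         (trans (cong₂ (λ a b → (a * b) mod2^ n) (coh x n) (coh y n))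
                (sym (%-distribˡ-* (seq x n) (seq y n) (2 ^ n) {{m^n≢0 2 n}})))

-- ℤ₂[ω] with ω^e = 2, i.e. ℤ₂[X]/(X^e - 2): an element is its coordinate
-- vector (a_0, …, a_{e-1}) in the ℤ₂-basis 1, ω, …, ω^{e-1}.

ℤ₂[ω] : ℕ → Set
ℤ₂[ω] e = Fin e → ℤ₂

_≈ω_ : ∀ {e} → ℤ₂[ω] e → ℤ₂[ω] e → Set
x ≈ω y = ∀ k → x k ≈₂ y k

_+ω_ : ∀ {e} → ℤ₂[ω] e → ℤ₂[ω] e → ℤ₂[ω] e
(x +ω y) k = x k +₂ y k

sum₂ : ∀ {m} → (Fin m → ℤ₂) → ℤ₂
sum₂ = foldr _+₂_ 0₂

-- a_i ω^i · b_j ω^j contributes to coordinate k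
--   a_i b_j      if i + j = k
--   2 a_i b_j    if i + j = k + e   (since ω^e = 2)
_*ω_ : ∀ {e} → ℤ₂[ω] e → ℤ₂[ω] e → ℤ₂[ω] e
_*ω_ {e} x y k = sum₂ λ i → sum₂ λ j → term i j
  where
  term : Fin e → Fin e → ℤ₂
  term i j with toℕ i + toℕ j ≟ toℕ k
  ... | yes _ = x i *₂ y j
  ... | no _ with toℕ i + toℕ j ≟ toℕ k + e
  ...   | yes _ = 2₂ *₂ (x i *₂ y j)
  ...   | no _ = 0₂

ι : ∀ {e} → ℤ₂ → ℤ₂[ω] e
ι {e} a k with toℕ k ≟ 0
... | yes _ = a
... | no _ = 0₂

-- the element ω (coordinate 1 equal to 1; requires e ≥ 2)
ω : ∀ {e} → ℤ₂[ω] e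
ω k with toℕ k ≟ 1
... | yes _ = 1₂
... | no _ = 0₂

_^ω_ : ∀ {e} → ℤ₂[ω] e → ℕ → ℤ₂[ω] e
x ^ω zero = ι 1₂
x ^ω suc n = x *ω (x ^ω n)

{-# OPTIONS --safe #-}

-- Write x = Σ aᵢ ωⁱ and y = Σ bᵢ ωⁱ and read the equation x² + y² = ω^(e+1) = 2ω at a finite
-- level 2ⁿ, where multiplication in ℤ₂[ω] is multiplication in ℕ[t]/(tᵉ − 2) of representatives
-- of the coordinates.
-- For e = 2 there is already no solution modulo 8, as an enumeration of residues confirms.
-- For e ≥ 4 look at the coefficients of 1, ω and ω² modulo 2, 4 and 2.  The products that wrap
-- around through tᵉ = 2 contribute 2 · (something), and at ω that something is a symmetric sum
-- with no diagonal (e + 1 is odd), hence even.  What remains involves only a₀, a₁, a₂, b₀, b₁, b₂: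
-- a₀² + b₀² and a₁² + b₁² are even, so a₀ ≡ b₀ and a₁ ≡ b₁ (mod 2), and then
-- 2(a₀a₁ + b₀b₁) ≡ 0 (mod 4) contradicts the coefficient 2 of ω.

module Submission where

open import Defs
open import Data.Nat using (ℕ; zero; suc; _+_; _*_; _^_; _≤_; _<_; _≟_; NonZero; z≤n; s≤s)
open import Data.Nat.Properties
  using (+-*-semiring; +-identityʳ; +-comm; +-assoc; *-comm; *-identityˡ; *-zeroʳ; +-cancelʳ-≡;
         suc-injective; m+1+n≢m; ≤-refl; ≤-trans; <⇒≤; <⇒≢; <⇒≱; <-≤-trans; m≤m+n; m≤n+m;
         m^n≢0; allUpTo?)
open import Data.Nat.DivMod using (_%_; %-distribˡ-+; %-distribˡ-*; m%n%n≡m%n; m%n<n; %-remove-+ʳ; m∣n⇒o%n%m≡o%m)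
open import Data.Nat.Divisibility using (_∣_; _∤_; divides; _∣0; ∣-refl; ∣m∣n⇒∣m+n; ∣m+n∣m⇒∣n; m∣m*n; *-monoʳ-∣; ∣1⇒≡1)
open import Data.Fin using (Fin; zero; suc; toℕ; fromℕ<; _↑ˡ_; _↑ʳ_)
open import Data.Fin.Properties using (toℕ-fromℕ<; toℕ<n; toℕ-↑ˡ; toℕ-↑ʳ; all?)
open import Data.Fin.Patterns using (0F; 1F; 2F)
open import Data.Vec.Functional using (_∷_; [])
open import Data.Product using (∃₂; _×_; _,_)
open import Function using (_∘_)
open import Relation.Nullary using (¬_; Dec; yes; no; ¬?)
open import Relation.Nullary.Decidable using (toWitness; _×-dec_)
open import Relation.Nullary.Negation using (contradiction)
open import Relation.Binary.PropositionalEquality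
  using (_≡_; _≢_; _≗_; refl; sym; trans; cong; cong₂; subst; module ≡-Reasoning)
open import Algebra.Properties.Semiring.Sum +-*-semiring
  using (sum; sum-cong-≗; sum-replicate-zero; ∑-distrib-+; *-distribˡ-sum)

open ≡-Reasoning

sum-zero : ∀ {m} {f : Fin m → ℕ} → (∀ i → f i ≡ 0) → sum f ≡ 0
sum-zero {m} f≗0 = trans (sum-cong-≗ f≗0) (sum-replicate-zero m)

sum-single : ∀ {m} (f : Fin m → ℕ) {a} (a<m : a < m) → (∀ i → toℕ i ≢ a → f i ≡ 0) →
             sum f ≡ f (fromℕ< a<m)
sum-single {suc m} f {zero}  _         vanish =
  trans (cong (f zero +_) (sum-zero λ i → vanish (suc i) λ ())) (+-identityʳ _)
sum-single {suc m} f {suc a} (s≤s a<m) vanish =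
  cong₂ _+_ (vanish zero λ ()) (sum-single (f ∘ suc) a<m λ i i≢a → vanish (suc i) (i≢a ∘ suc-injective))

sum-linear : ∀ {m} c (f g : Fin m → ℕ) → sum (λ i → f i + c * g i) ≡ sum f + c * sum g
sum-linear c f g = begin
  sum (λ i → f i + c * g i)    ≡⟨ ∑-distrib-+ f (λ i → c * g i) ⟩
  sum f + sum (λ i → c * g i)  ≡⟨ cong (sum f +_) (*-distribˡ-sum c g) ⟨
  sum f + c * sum g            ∎

sum-↑ˡ : ∀ m {e} (f : Fin (m + e) → ℕ) → (∀ i → f (m ↑ʳ i) ≡ 0) → sum f ≡ sum (f ∘ (_↑ˡ e))
sum-↑ˡ zero    f tail≡0 = sum-zero tail≡0
sum-↑ˡ (suc m) f tail≡0 = cong (f zero +_) (sum-↑ˡ m (f ∘ suc) tail≡0)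

sum-symmetric-even : ∀ {m} (F : Fin m → Fin m → ℕ) → (∀ i j → F i j ≡ F j i) → (∀ i → F i i ≡ 0) →
                     2 ∣ sum (λ i → sum (F i))
sum-symmetric-even {zero}  F _    _    = 2 ∣0
sum-symmetric-even {suc m} F symm diag =
  subst (2 ∣_) (sym split)
    (∣m∣n⇒∣m+n (m∣m*n R) (sum-symmetric-even F′ (λ i j → symm (suc i) (suc j)) (diag ∘ suc)))
  where
  F′ : Fin m → Fin m → ℕ
  F′ i j = F (suc i) (suc j)
  R S : ℕ
  R = sum (F zero ∘ suc)
  S = sum (λ i → sum (F′ i))
  split : sum (λ i → sum (F i)) ≡ 2 * R + S
  split = begin
    F zero zero + R + sum (λ i → F (suc i) zero + sum (F′ i))
      ≡⟨ cong₂ (λ u w → u + R + w) (diag zero) (∑-distrib-+ (λ i → F (suc i) zero) (λ i → sum (F′ i))) ⟩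
    R + (sum (λ i → F (suc i) zero) + S)
      ≡⟨ cong (λ w → R + (w + S)) (sum-cong-≗ λ i → symm (suc i) zero) ⟩
    R + (R + S)
      ≡⟨ +-assoc R R S ⟨
    R + R + S
      ≡⟨ cong (λ w → R + w + S) (+-identityʳ R) ⟨
    2 * R + S ∎

-- monomial c a s is the coefficient of tˢ in c tᵃ.
monomial : ℕ → ℕ → ℕ → ℕ
monomial c a s with a ≟ s
... | yes _ = c
... | no _  = 0

monomial-≡ : ∀ {c a s} → a ≡ s → monomial c a s ≡ c
monomial-≡ {a = a} {s} a≡s with a ≟ s
... | yes _   = refl
... | no a≢s = contradiction a≡s a≢s

monomial-≢ : ∀ {c a s} → a ≢ s → monomial c a s ≡ 0
monomial-≢ {a = a} {s} a≢s with a ≟ s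
... | yes a≡s = contradiction a≡s a≢s
... | no _    = refl

monomial-0 : ∀ {c} a s → c ≡ 0 → monomial c a s ≡ 0
monomial-0 a s refl with a ≟ s
... | yes _ = refl
... | no _  = refl

*-monomial : ∀ d c a s → d * monomial c a s ≡ monomial (d * c) a s
*-monomial d c a s with a ≟ s
... | yes _ = refl
... | no _  = *-zeroʳ d

monomial-+ʳ : ∀ c a s m → monomial c (a + m) (s + m) ≡ monomial c a s
monomial-+ʳ c a s m with a ≟ s
... | yes a≡s = monomial-≡ (cong (_+ m) a≡s)
... | no a≢s  = monomial-≢ (a≢s ∘ +-cancelʳ-≡ m a s)

convolution : ∀ {e} → (Fin e → ℕ) → (Fin e → ℕ) → ℕ → ℕ
convolution X Y s = sum λ i → sum λ j → monomial (X i * Y j) (toℕ i + toℕ j) s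

-- Multiplication of ℕ[t]/(tᵉ − 2) in the basis 1, t, …, tᵉ⁻¹.
_⊛_ : ∀ {e} → (Fin e → ℕ) → (Fin e → ℕ) → Fin e → ℕ
_⊛_ {e} X Y k = convolution X Y (toℕ k) + 2 * convolution X Y (toℕ k + e)

convolution-monomial : ∀ {e} {X Y : Fin e → ℕ} {c d a b} → a < e → b < e →
                       X ≗ monomial c a ∘ toℕ → Y ≗ monomial d b ∘ toℕ →
                       ∀ s → convolution X Y s ≡ monomial (c * d) (a + b) s
convolution-monomial {e} {X} {Y} {c} {d} {a} {b} a<e b<e X≗ Y≗ s = begin
  convolution X Y s
    ≡⟨ sum-single (λ i → sum λ j → monomial (X i * Y j) (toℕ i + toℕ j) s) a<e
         (λ i i≢a → sum-zero λ j → monomial-0 _ s (cong (_* Y j) (X-vanishes i i≢a))) ⟩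
  sum (λ j → monomial (X i₀ * Y j) (toℕ i₀ + toℕ j) s)
    ≡⟨ sum-single (λ j → monomial (X i₀ * Y j) (toℕ i₀ + toℕ j) s) b<e
         (λ j j≢b → monomial-0 _ s (trans (cong (X i₀ *_) (Y-vanishes j j≢b)) (*-zeroʳ (X i₀)))) ⟩
  monomial (X i₀ * Y j₀) (toℕ i₀ + toℕ j₀) s
    ≡⟨ cong₂ (λ u v → monomial u v s) (cong₂ _*_ Xi₀≡c Yj₀≡d) (cong₂ _+_ (toℕ-fromℕ< a<e) (toℕ-fromℕ< b<e)) ⟩
  monomial (c * d) (a + b) s ∎
  where
  i₀ j₀ : Fin e
  i₀ = fromℕ< a<e
  j₀ = fromℕ< b<e
  X-vanishes : ∀ i → toℕ i ≢ a → X i ≡ 0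
  X-vanishes i i≢a = trans (X≗ i) (monomial-≢ (i≢a ∘ sym))
  Y-vanishes : ∀ j → toℕ j ≢ b → Y j ≡ 0
  Y-vanishes j j≢b = trans (Y≗ j) (monomial-≢ (j≢b ∘ sym))
  Xi₀≡c : X i₀ ≡ c
  Xi₀≡c = trans (X≗ i₀) (monomial-≡ (sym (toℕ-fromℕ< a<e)))
  Yj₀≡d : Y j₀ ≡ d
  Yj₀≡d = trans (Y≗ j₀) (monomial-≡ (sym (toℕ-fromℕ< b<e)))

convolution-↑ˡ : ∀ {m} e (X Y : Fin (m + e) → ℕ) {s} → s < m →
                 convolution X Y s ≡ convolution (X ∘ (_↑ˡ e)) (Y ∘ (_↑ˡ e)) s
convolution-↑ˡ {m} e X Y {s} s<m = begin
  sum (λ i → sum (term i))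
    ≡⟨ sum-↑ˡ m (λ i → sum (term i))
         (λ i → sum-zero λ j → term-vanishes (m ↑ʳ i) j (≤-trans (m≤↑ʳ i) (m≤m+n _ _))) ⟩
  sum (λ i → sum (term (i ↑ˡ e)))
    ≡⟨ sum-cong-≗ (λ i → sum-↑ˡ m (term (i ↑ˡ e))
         λ j → term-vanishes (i ↑ˡ e) (m ↑ʳ j) (≤-trans (m≤↑ʳ j) (m≤n+m _ _))) ⟩
  sum (λ i → sum λ j → term (i ↑ˡ e) (j ↑ˡ e))
    ≡⟨ sum-cong-≗ (λ i → sum-cong-≗ λ j →
         cong₂ (λ a b → monomial (X (i ↑ˡ e) * Y (j ↑ˡ e)) (a + b) s) (toℕ-↑ˡ i e) (toℕ-↑ˡ j e)) ⟩
  convolution (X ∘ (_↑ˡ e)) (Y ∘ (_↑ˡ e)) s ∎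
  where
  term : Fin (m + e) → Fin (m + e) → ℕ
  term i j = monomial (X i * Y j) (toℕ i + toℕ j) s
  m≤↑ʳ : ∀ i → m ≤ toℕ (m ↑ʳ i)
  m≤↑ʳ i = subst (m ≤_) (sym (toℕ-↑ʳ m i)) (m≤m+n m (toℕ i))
  term-vanishes : ∀ i j → m ≤ toℕ i + toℕ j → term i j ≡ 0
  term-vanishes i j m≤i+j = monomial-≢ λ i+j≡s → <⇒≱ s<m (subst (m ≤_) i+j≡s m≤i+j)

odd⇒convolution-self-even : ∀ {e} (X : Fin e → ℕ) {s} → 2 ∤ s → 2 ∣ convolution X X s
odd⇒convolution-self-even X {s} s-odd =
  sum-symmetric-even _ (λ i j → cong₂ (λ c a → monomial c a s) (*-comm (X i) (X j)) (+-comm (toℕ i) (toℕ j)))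
                       (λ i → monomial-≢ λ i+i≡s → s-odd (subst (2 ∣_) i+i≡s (2∣i+i (toℕ i))))
  where
  2∣i+i : ∀ i → 2 ∣ i + i
  2∣i+i i = divides i (trans (cong (i +_) (sym (+-identityʳ i))) (*-comm 2 i))

2∣n⇒2∤1+n : ∀ {n} → 2 ∣ n → 2 ∤ suc n
2∣n⇒2∤1+n {n} 2∣n 2∣1+n with ∣1⇒≡1 (∣m+n∣m⇒∣n (subst (2 ∣_) (+-comm 1 n) 2∣1+n) 2∣n)
... | ()

infix 4 _≡_mod_
_≡_mod_ : ℕ → ℕ → (d : ℕ) → .{{NonZero d}} → Set
_≡_mod_ a b d = a % d ≡ b % d

module _ {d : ℕ} .{{_ : NonZero d}} where

  +-cong-mod : ∀ {a a′ b b′} → a ≡ a′ mod d → b ≡ b′ mod d → a + b ≡ a′ + b′ mod d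
  +-cong-mod {a} {a′} {b} {b′} a≡a′ b≡b′ = begin
    (a + b) % d              ≡⟨ %-distribˡ-+ a b d ⟩
    (a % d + b % d) % d      ≡⟨ cong₂ (λ u v → (u + v) % d) a≡a′ b≡b′ ⟩
    (a′ % d + b′ % d) % d    ≡⟨ %-distribˡ-+ a′ b′ d ⟨
    (a′ + b′) % d            ∎

  *-cong-mod : ∀ {a a′ b b′} → a ≡ a′ mod d → b ≡ b′ mod d → a * b ≡ a′ * b′ mod d
  *-cong-mod {a} {a′} {b} {b′} a≡a′ b≡b′ = begin
    (a * b) % d              ≡⟨ %-distribˡ-* a b d ⟩
    (a % d * (b % d)) % d    ≡⟨ cong₂ (λ u v → (u * v) % d) a≡a′ b≡b′ ⟩
    (a′ % d * (b′ % d)) % d  ≡⟨ %-distribˡ-* a′ b′ d ⟨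
    (a′ * b′) % d            ∎

  sum-cong-mod : ∀ {m} {f g : Fin m → ℕ} → (∀ i → f i ≡ g i mod d) → sum f ≡ sum g mod d
  sum-cong-mod {zero}  _   = refl
  sum-cong-mod {suc m} f≡g = +-cong-mod (f≡g zero) (sum-cong-mod (f≡g ∘ suc))

  monomial-cong-mod : ∀ {c c′} a s → c ≡ c′ mod d → monomial c a s ≡ monomial c′ a s mod d
  monomial-cong-mod a s c≡c′ with a ≟ s
  ... | yes _ = c≡c′
  ... | no _  = refl

  convolution-cong-mod : ∀ {e} {X X′ Y Y′ : Fin e → ℕ} → (∀ i → X i ≡ X′ i mod d) → (∀ j → Y j ≡ Y′ j mod d) →
                         ∀ s → convolution X Y s ≡ convolution X′ Y′ s mod d
  convolution-cong-mod X≡X′ Y≡Y′ s =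
    sum-cong-mod λ i → sum-cong-mod λ j → monomial-cong-mod _ s (*-cong-mod (X≡X′ i) (Y≡Y′ j))

  ⊛-cong-mod : ∀ {e} {X X′ Y Y′ : Fin e → ℕ} → (∀ i → X i ≡ X′ i mod d) → (∀ j → Y j ≡ Y′ j mod d) →
               ∀ k → (X ⊛ Y) k ≡ (X′ ⊛ Y′) k mod d
  ⊛-cong-mod {e} X≡X′ Y≡Y′ k =
    +-cong-mod (convolution-cong-mod X≡X′ Y≡Y′ (toℕ k))
               (*-cong-mod {2} refl (convolution-cong-mod X≡X′ Y≡Y′ (toℕ k + e)))

mod-divisor : ∀ {d d′} .{{_ : NonZero d}} .{{_ : NonZero d′}} → d ∣ d′ → ∀ {a b} → a ≡ b mod d′ → a ≡ b mod d
mod-divisor {d} {d′} d∣d′ {a} {b} a≡b = begin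
  a % d         ≡⟨ m∣n⇒o%n%m≡o%m d d′ a d∣d′ ⟨
  a % d′ % d    ≡⟨ cong (_% d) a≡b ⟩
  b % d′ % d    ≡⟨ m∣n⇒o%n%m≡o%m d d′ b d∣d′ ⟩
  b % d         ∎

coords : ∀ {e} → ℕ → ℤ₂[ω] e → Fin e → ℕ
coords n x k = seq (x k) n

seq-sum₂ : ∀ {m} (f : Fin m → ℤ₂) n → seq (sum₂ f) n ≡ sum (λ i → seq (f i) n)
seq-sum₂ {zero}  f n = refl
seq-sum₂ {suc m} f n = cong (seq (f zero) n +_) (seq-sum₂ (f ∘ suc) n)

mutual
  seq-*ω : ∀ {e} (x y : ℤ₂[ω] e) n k → seq ((x *ω y) k) n ≡ (coords n x ⊛ coords n y) k
  seq-*ω {e} x y n k = begin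
    seq ((x *ω y) k) n
      ≡⟨ trans (seq-sum₂ {e} _ n) (sum-cong-≗ λ i → trans (seq-sum₂ {e} _ n) (sum-cong-≗ (seq-*ω-summand x y n k i))) ⟩
    sum (λ i → sum λ j → term (toℕ k) i j + 2 * term (toℕ k + e) i j)
      ≡⟨ sum-cong-≗ (λ i → sum-linear 2 (term (toℕ k) i) (term (toℕ k + e) i)) ⟩
    sum (λ i → sum (term (toℕ k) i) + 2 * sum (term (toℕ k + e) i))
      ≡⟨ sum-linear 2 (λ i → sum (term (toℕ k) i)) (λ i → sum (term (toℕ k + e) i)) ⟩
    (coords n x ⊛ coords n y) k ∎
    where
    term : ℕ → Fin e → Fin e → ℕ
    term s i j = monomial (coords n x i * coords n y j) (toℕ i + toℕ j) s

  -- The summand of _*ω_ is local to its where block, so its type is left for seq-*ω to fix.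
  seq-*ω-summand : ∀ {e} (x y : ℤ₂[ω] e) n k i j →
    _ ≡ monomial (coords n x i * coords n y j) (toℕ i + toℕ j) (toℕ k)
        + 2 * monomial (coords n x i * coords n y j) (toℕ i + toℕ j) (toℕ k + e)
  seq-*ω-summand {suc e} x y n k i j with toℕ i + toℕ j ≟ toℕ k
  ... | yes i+j≡k with toℕ i + toℕ j ≟ toℕ k + suc e
  ...   | yes i+j≡k+e = contradiction (trans (sym i+j≡k+e) i+j≡k) (m+1+n≢m (toℕ k))
  ...   | no _        = sym (+-identityʳ _)
  seq-*ω-summand {suc e} x y n k i j | no _ with toℕ i + toℕ j ≟ toℕ k + suc e
  ...   | yes _ = refl
  ...   | no _  = refl

seq-ι : ∀ {e} a n (k : Fin e) → seq (ι a k) n ≡ monomial (seq a n) 0 (toℕ k)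
seq-ι a n k with toℕ k ≟ 0
... | yes k≡0 = sym (monomial-≡ (sym k≡0))
... | no k≢0  = sym (monomial-≢ (k≢0 ∘ sym))

seq-ω : ∀ {e} n (k : Fin e) → seq (ω k) n ≡ monomial 1 1 (toℕ k)
seq-ω n k with toℕ k ≟ 1
... | yes k≡1 = sym (monomial-≡ (sym k≡1))
... | no k≢1  = sym (monomial-≢ (k≢1 ∘ sym))

module _ {e} (e≥2 : 2 ≤ e) (v : ℤ₂[ω] e) {c j} (j<e : j < e)
         (v≗ : ∀ n → coords n v ≗ monomial c j ∘ toℕ) where

  coords-ω*ω : ∀ n k → seq ((ω *ω v) k) n ≡ monomial c (suc j) (toℕ k) + 2 * monomial c (suc j) (toℕ k + e)
  coords-ω*ω n k = begin
    seq ((ω *ω v) k) n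
      ≡⟨ seq-*ω ω v n k ⟩
    convolution W V (toℕ k) + 2 * convolution W V (toℕ k + e)
      ≡⟨ cong₂ (λ u w → u + 2 * w) (convolution-monomial e≥2 j<e (seq-ω n) (v≗ n) (toℕ k))
                                   (convolution-monomial e≥2 j<e (seq-ω n) (v≗ n) (toℕ k + e)) ⟩
    monomial (1 * c) (suc j) (toℕ k) + 2 * monomial (1 * c) (suc j) (toℕ k + e)
      ≡⟨ cong (λ c′ → monomial c′ (suc j) (toℕ k) + 2 * monomial c′ (suc j) (toℕ k + e)) (*-identityˡ c) ⟩
    monomial c (suc j) (toℕ k) + 2 * monomial c (suc j) (toℕ k + e) ∎
    where
    W V : Fin e → ℕ
    W = coords n ω
    V = coords n v

  coords-ω*ω-< : suc j < e → ∀ n → coords n (ω *ω v) ≗ monomial c (suc j) ∘ toℕ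
  coords-ω*ω-< 1+j<e n k = begin
    seq ((ω *ω v) k) n
      ≡⟨ coords-ω*ω n k ⟩
    monomial c (suc j) (toℕ k) + 2 * monomial c (suc j) (toℕ k + e)
      ≡⟨ cong (λ w → monomial c (suc j) (toℕ k) + 2 * w) (monomial-≢ 1+j≢k+e) ⟩
    monomial c (suc j) (toℕ k) + 0
      ≡⟨ +-identityʳ _ ⟩
    monomial c (suc j) (toℕ k) ∎
    where
    1+j≢k+e : suc j ≢ toℕ k + e
    1+j≢k+e = <⇒≢ (<-≤-trans 1+j<e (m≤n+m e (toℕ k)))

  coords-ω*ω-≡ : suc j ≡ e → ∀ n → coords n (ω *ω v) ≗ monomial (2 * c) 0 ∘ toℕ
  coords-ω*ω-≡ refl n k = begin
    seq ((ω *ω v) k) n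
      ≡⟨ coords-ω*ω n k ⟩
    monomial c (suc j) (toℕ k) + 2 * monomial c (suc j) (toℕ k + e)
      ≡⟨ cong₂ (λ u w → u + 2 * w) (monomial-≢ (<⇒≢ (toℕ<n k) ∘ sym)) (monomial-+ʳ c 0 (toℕ k) e) ⟩
    2 * monomial c 0 (toℕ k)
      ≡⟨ *-monomial 2 c 0 (toℕ k) ⟩
    monomial (2 * c) 0 (toℕ k) ∎

coords-ω^ : ∀ {e} → 2 ≤ e → ∀ {j} → j < e → ∀ n → coords n (ω {e} ^ω j) ≗ monomial 1 j ∘ toℕ
coords-ω^ e≥2 {zero}  _   n = seq-ι 1₂ n
coords-ω^ e≥2 {suc j} j<e   = coords-ω*ω-< e≥2 (ω ^ω j) (<⇒≤ j<e) (coords-ω^ e≥2 (<⇒≤ j<e)) j<e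

coords-ω^[e+1] : ∀ {e} → 2 ≤ e → ∀ n → coords n (ω {e} ^ω (e + 1)) ≗ monomial 2 1 ∘ toℕ
coords-ω^[e+1] {suc e} e≥2 rewrite +-comm e 1 =
  coords-ω*ω-< e≥2 (ω ^ω suc e) (s≤s z≤n)
    (coords-ω*ω-≡ e≥2 (ω ^ω e) ≤-refl (coords-ω^ e≥2 {e} ≤-refl) refl) e≥2

SquaresSumTo2ω : ∀ {e} (d : ℕ) .{{_ : NonZero d}} → (Fin e → ℕ) → (Fin e → ℕ) → Set
SquaresSumTo2ω d A B = ∀ k → (A ⊛ A) k + (B ⊛ B) k ≡ monomial 2 1 (toℕ k) mod d

squares-sum-to-2ω? : ∀ {e} (d : ℕ) .{{_ : NonZero d}} (A B : Fin e → ℕ) → Dec (SquaresSumTo2ω d A B)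
squares-sum-to-2ω? d A B = all? λ k → ((A ⊛ A) k + (B ⊛ B) k) % d ≟ monomial 2 1 (toℕ k) % d

SquaresSumTo2ω-residues : ∀ {e d} .{{_ : NonZero d}} (A B : Fin e → ℕ) → SquaresSumTo2ω d A B →
                          SquaresSumTo2ω d (λ i → A i % d) (λ i → B i % d)
SquaresSumTo2ω-residues {d = d} A B sol k =
  trans (+-cong-mod (⊛-cong-mod A%≡A A%≡A k) (⊛-cong-mod B%≡B B%≡B k)) (sol k)
  where
  A%≡A : ∀ i → A i % d ≡ A i mod d
  A%≡A i = m%n%n≡m%n (A i) d
  B%≡B : ∀ i → B i % d ≡ B i mod d
  B%≡B i = m%n%n≡m%n (B i) d

coords-SquaresSumTo2ω : ∀ {e} → 2 ≤ e → (x y : ℤ₂[ω] e) → ((x *ω x) +ω (y *ω y)) ≈ω (ω ^ω (e + 1)) →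
                        ∀ n → SquaresSumTo2ω (2 ^ n) {{m^n≢0 2 n}} (coords n x) (coords n y)
coords-SquaresSumTo2ω {e} e≥2 x y x²+y²≈ω^[e+1] n k = begin
  ((coords n x ⊛ coords n x) k + (coords n y ⊛ coords n y) k) mod2^ n
    ≡⟨ cong (_mod2^ n) (cong₂ _+_ (seq-*ω x x n k) (seq-*ω y y n k)) ⟨
  seq (((x *ω x) +ω (y *ω y)) k) n mod2^ n
    ≡⟨ x²+y²≈ω^[e+1] k n ⟩
  seq ((ω ^ω (e + 1)) k) n mod2^ n
    ≡⟨ cong (_mod2^ n) (coords-ω^[e+1] e≥2 n k) ⟩
  monomial 2 1 (toℕ k) mod2^ n ∎

-- For x = a + bω and y = c + dω the coefficient of ω makes ab + cd odd and the constant one makes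
-- a ≡ c (mod 2); so a, c and b + d are odd, and then a² + c² + 2(b² + d²) ≡ 2 + 2 (mod 8).
no-residue-solution-mod-8 : ∀ {a} → a < 8 → ∀ {b} → b < 8 → ∀ {c} → c < 8 → ∀ {d} → d < 8 →
                            ¬ SquaresSumTo2ω 8 (a ∷ b ∷ []) (c ∷ d ∷ [])
no-residue-solution-mod-8 = toWitness {a? = allUpTo? (λ a → allUpTo? (λ b → allUpTo? (λ c → allUpTo? (λ d →
  ¬? (squares-sum-to-2ω? 8 (a ∷ b ∷ []) (c ∷ d ∷ []))) 8) 8) 8) 8} _

no-solution-mod-8 : (A B : Fin 2 → ℕ) → ¬ SquaresSumTo2ω 8 A B
no-solution-mod-8 A B sol =
  no-residue-solution-mod-8 (m%n<n (A 0F) 8) (m%n<n (A 1F) 8) (m%n<n (B 0F) 8) (m%n<n (B 1F) 8)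
    -- splitting on k makes the residue vectors unfold to the literal vectors of the enumeration
    λ { 0F → SquaresSumTo2ω-residues A B sol 0F ; 1F → SquaresSumTo2ω-residues A B sol 1F }

LowSquaresSumTo2ω : (A B : Fin 3 → ℕ) → Set
LowSquaresSumTo2ω A B = c 0 ≡ 0 mod 2 × c 1 ≡ 2 mod 4 × c 2 ≡ 0 mod 2
  where
  c : ℕ → ℕ
  c s = convolution A A s + convolution B B s

low-squares-sum-to-2ω? : (A B : Fin 3 → ℕ) → Dec (LowSquaresSumTo2ω A B)
low-squares-sum-to-2ω? A B = c 0 % 2 ≟ 0 ×-dec c 1 % 4 ≟ 2 ×-dec c 2 % 2 ≟ 0
  where
  c : ℕ → ℕ
  c s = convolution A A s + convolution B B s

-- The outer conditions force a₀ ≡ b₀ and a₁ ≡ b₁ (mod 2), so c 1 = 2(a₀a₁ + b₀b₁) ≡ 0 (mod 4).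
no-low-residue-solution-mod-4 : ∀ {a₀} → a₀ < 4 → ∀ {a₁} → a₁ < 4 → ∀ {a₂} → a₂ < 4 →
                                ∀ {b₀} → b₀ < 4 → ∀ {b₁} → b₁ < 4 → ∀ {b₂} → b₂ < 4 →
                                ¬ LowSquaresSumTo2ω (a₀ ∷ a₁ ∷ a₂ ∷ []) (b₀ ∷ b₁ ∷ b₂ ∷ [])
no-low-residue-solution-mod-4 = toWitness {a? =
  allUpTo? (λ a₀ → allUpTo? (λ a₁ → allUpTo? (λ a₂ → allUpTo? (λ b₀ → allUpTo? (λ b₁ → allUpTo? (λ b₂ →
    ¬? (low-squares-sum-to-2ω? (a₀ ∷ a₁ ∷ a₂ ∷ []) (b₀ ∷ b₁ ∷ b₂ ∷ []))) 4) 4) 4) 4) 4) 4} _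

no-solution-mod-4 : ∀ {e} → 2 ∣ 3 + e → (A B : Fin (3 + e) → ℕ) → ¬ SquaresSumTo2ω 4 A B
no-solution-mod-4 {e} 2∣3+e A B sol =
  no-low-residue-solution-mod-4 (m%n<n (A 0F) 4) (m%n<n (A 1F) 4) (m%n<n (A 2F) 4)
                                (m%n<n (B 0F) 4) (m%n<n (B 1F) 4) (m%n<n (B 2F) 4)
    ( low (divides 2 refl) 0F (s≤s z≤n) (wrap-even 0F)
    , low ∣-refl 1F (s≤s (s≤s z≤n)) (λ X → *-monoʳ-∣ 2 (odd⇒convolution-self-even X (2∣n⇒2∤1+n 2∣3+e)))
    , low (divides 2 refl) 2F (s≤s (s≤s (s≤s z≤n))) (wrap-even 2F) )
  where
  A′ B′ : Fin (3 + e) → ℕ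
  A′ i = A i % 4
  B′ i = B i % 4
  wrap-even : ∀ (k : Fin (3 + e)) (X : Fin (3 + e) → ℕ) → 2 ∣ 2 * convolution X X (toℕ k + (3 + e))
  wrap-even k X = m∣m*n (convolution X X (toℕ k + (3 + e)))
  low : ∀ {d} .{{_ : NonZero d}} → d ∣ 4 → (k : Fin (3 + e)) → toℕ k < 3 →
        (∀ X → d ∣ 2 * convolution X X (toℕ k + (3 + e))) →
        convolution (A′ ∘ (_↑ˡ e)) (A′ ∘ (_↑ˡ e)) (toℕ k) + convolution (B′ ∘ (_↑ˡ e)) (B′ ∘ (_↑ˡ e)) (toℕ k)
          ≡ monomial 2 1 (toℕ k) mod d
  low {d} d∣4 k k<3 wrap = begin
    (convolution (A′ ∘ (_↑ˡ e)) (A′ ∘ (_↑ˡ e)) s + convolution (B′ ∘ (_↑ˡ e)) (B′ ∘ (_↑ˡ e)) s) % d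
      ≡⟨ cong (_% d) (cong₂ _+_ (convolution-↑ˡ e A′ A′ k<3) (convolution-↑ˡ e B′ B′ k<3)) ⟨
    (convolution A′ A′ s + convolution B′ B′ s) % d
      ≡⟨ +-cong-mod (%-remove-+ʳ (convolution A′ A′ s) (wrap A′)) (%-remove-+ʳ (convolution B′ B′ s) (wrap B′)) ⟨
    ((A′ ⊛ A′) k + (B′ ⊛ B′) k) % d
      ≡⟨ mod-divisor d∣4 (SquaresSumTo2ω-residues A B sol k) ⟩
    monomial 2 1 s % d ∎
    where
    s : ℕ
    s = toℕ k

lemma3p11 : (e : ℕ) → 2 ≤ e → 2 ∣ e →
    ¬ (∃₂ λ (x y : ℤ₂[ω] e) → ((x *ω x) +ω (y *ω y)) ≈ω (ω ^ω (e + 1)))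
lemma3p11 (suc zero)          (s≤s ()) _
lemma3p11 (suc (suc zero))    e≥2 _     (x , y , h) =
  no-solution-mod-8 (coords 3 x) (coords 3 y) (coords-SquaresSumTo2ω e≥2 x y h 3)
lemma3p11 (suc (suc (suc e))) e≥2 2∣3+e (x , y , h) =
  no-solution-mod-4 2∣3+e (coords 2 x) (coords 2 y) (coords-SquaresSumTo2ω e≥2 x y h 2)
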